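{- Let $\sigma\in S_k$. For every nonnegative integer $l$ there is a bijection between $P(\sigma,l)$ and $\mathcal{F}(\sigma,l)$.
   Context: The unitary Weingarten graph is the directed graph with vertex set $\bigsqcup_{k\ge0}S_k$ ($S_0=\{\emptyset\}$), with a solid arrow $\sigma\to(i,k)\sigma$ for each $\sigma\in S_k$, $k\ge2$, and $1\le i<k$, and a dashed arrow $\sigma\dashrightarrow\sigma^{\downarrow}$ whenever $\sigma\in S_k$, $k\ge1$, satisfies $\sigma(k)=k$, where $\sigma^{\downarrow}\in S_{k-1}$ is the restriction of $\sigma$ to $\{1,\dots,k-1\}$. For $\sigma\in S_k$ and $l\ge0$, $P(\sigma,l)$ is the set of paths $(\sigma_0=\sigma,\dots,\sigma_{l+k}=\emptyset)$ following arrows (solid or dashed) at each step; such a path uses exactly $k$ dashed and $l$ solid arrows. A monotone factorization of length $l$ of $\sigma\in S_k$ is a sequence $(\tau_1,\dots,\tau_l)$ of transpositions $\tau_i=(s_i,t_i)$ with $1\le s_i<t_i\le k$, $k\ge t_1\ge t_2\ge\cdots\ge t_l\ge1$, and $\sigma=\tau_1\tau_2\cdots\tau_l$. $\mathcal{F}(\sigma,l)$ denotes the set of these. -}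

module Defs where

open import Data.Nat using (ℕ; zero; suc; _+_; _≤_; _<_)
open import Data.Fin using (Fin; toℕ; inject₁; fromℕ)
open import Data.Fin.Permutation using (Permutation′; _⟨$⟩ʳ_; _∘ₚ_; transpose; remove; id)
open import Data.Product using (Σ; _×_; _,_; proj₁; proj₂)
open import Data.Sum using (_⊎_)
open import Data.Unit using (⊤)
open import Data.Empty using (⊥)
open import Data.Vec using (Vec; []; _∷_; map)
open import Data.Vec.Relation.Unary.All using (All)
open import Relation.Binary.PropositionalEquality using (_≡_)

-- S_k, represented by the standard library's permutations of Fin k
-- (points 1..k of the paper are 0..k-1 here).
Perm : ℕ → Set
Perm k = Permutation′ k

-- Product in S_k with the usual right-to-left convention:
-- (π · ρ)(x) = π(ρ(x)).
_·_ : ∀ {k} → Perm k → Perm k → Perm k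
π · ρ = ρ ∘ₚ π

-- The transposition (i, k) in S_k (k = suc m), for 1 ≤ i < k;
-- i is encoded by j : Fin m (i = toℕ j + 1).
τ : ∀ {m} → Fin m → Perm (suc m)
τ {m} j = transpose (inject₁ j) (fromℕ m)

FixesLast : ∀ {m} → Perm (suc m) → Set
FixesLast {m} σ = σ ⟨$⟩ʳ fromℕ m ≡ fromℕ m

-- σ↓ : restriction of σ to {1,…,k-1}; when σ(k) = k the library's
-- `remove (fromℕ m)` is exactly x ↦ σ(x).
restrict : ∀ {m} → Perm (suc m) → Perm m
restrict {m} σ = remove (fromℕ m) σ

-- Walks σ = σ₀ → σ₁ → … → σₙ = ∅ of exactly n arrows in the unitary
-- Weingarten graph, recorded by the arrow taken at each step
-- (arrows out of a vertex have pairwise distinct targets, so this is the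
-- same as the vertex sequence).
Walk : (k : ℕ) → Perm k → ℕ → Set
Walk zero    σ zero    = ⊤
Walk zero    σ (suc n) = ⊥
Walk (suc m) σ zero    = ⊥
Walk (suc m) σ (suc n) =
  (Σ (Fin m) λ j → Walk (suc m) (τ j · σ) n)      -- solid arrow σ → (i,k)σ
  ⊎ (FixesLast σ × Walk m (restrict σ) n)          -- dashed arrow σ ⇢ σ↓

P : ∀ {k} → Perm k → ℕ → Set
P {k} σ l = Walk k σ (l + k)

Desc : ∀ {n} → Vec ℕ n → Set
Desc []           = ⊤
Desc (x ∷ [])     = ⊤
Desc (x ∷ y ∷ xs) = y ≤ x × Desc (y ∷ xs)

prod : ∀ {k l} → Vec (Fin k × Fin k) l → Perm k
prod []             = id
prod ((s , t) ∷ ts) = transpose s t · prod ts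

-- The properties are
-- irrelevant fields, so an element is determined by its sequence of
-- transpositions; equality σ = τ₁⋯τ_l of permutations is pointwise.
record F {k : ℕ} (σ : Perm k) (l : ℕ) : Set where
  field
    ts   : Vec (Fin k × Fin k) l
    .lt  : All (λ p → toℕ (proj₁ p) < toℕ (proj₂ p)) ts
    .mono : Desc (map (λ p → toℕ (proj₂ p)) ts)
    .fact : ∀ x → σ ⟨$⟩ʳ x ≡ prod ts ⟨$⟩ʳ x

module Submission where

-- Both families satisfy the same recursion.  For σ ∈ S_{m+1}, a walk starts
-- with a solid arrow σ → (j, m+1)σ or, if σ fixes m+1, with the dashed arrow
-- σ ⇢ σ↓.  Dually, a monotone factorization of σ either begins with some
-- (j, m+1), the rest factorizing (j, m+1)σ, or, its tops being non-increasing,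
-- it never moves m+1; then σ fixes m+1 and the factorization is one of σ↓
-- lifted along S_m ⊂ S_{m+1}.  A walk without solid arrows left must be dashed
-- (else it is too short), as a factorization of length 0 never moves m+1.

open import Defs
open import Data.Nat using (ℕ; zero; suc; _<_; s≤s⁻¹)
open import Data.Nat.Properties using (<-irrefl; <-trans; ≤-<-trans; n<1+n; +-suc)
open import Data.Fin using (Fin; toℕ; inject₁; fromℕ; fromℕ<; punchIn; _≟_)
import Data.Fin as Fin
open import Data.Fin.Properties using (toℕ-injective; toℕ-inject₁; toℕ-fromℕ; toℕ-fromℕ<; inject₁-injective; inject₁ℕ<; fromℕ≢inject₁; ≤fromℕ)
open import Data.Fin.Relation.Unary.Top using (view; ‵fromℕ; ‵inject₁; view-fromℕ; view-inject₁)
open import Data.Fin.Permutation using (_⟨$⟩ʳ_; transpose; punchIn-permute)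
import Data.Fin.Permutation.Components as PC
open import Data.Product using (Σ-syntax; _×_; _,_; proj₁; proj₂; uncurry)
open import Data.Product.Function.NonDependent.Propositional using (_×-↔_)
open import Data.Product.Function.Dependent.Propositional using (congˡ)
open import Data.Sum using (_⊎_; inj₁; inj₂; [_,_])
open import Data.Sum.Function.Propositional using (_⊎-↔_)
open import Data.Unit using (⊤; tt)
open import Data.Empty using (⊥; ⊥-elim; ⊥-elim-irr)
open import Data.Vec using (Vec; []; _∷_; map)
import Data.Vec as Vec
open import Data.Vec.Properties using (map-∘; map-cong)
open import Data.Vec.Relation.Unary.All using (All; []; _∷_)
import Data.Vec.Relation.Unary.All as All
open import Function.Base using (_∘_)
open import Function.Bundles using (_↔_; _⤖_; mk↔ₛ′)
open import Function.Definitions using (Injective)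
open import Function.Properties.Inverse using (↔-refl; ↔-sym; ↔⇒⤖)
open import Function.Related.Propositional using (module EquationalReasoning)
open import Axiom.UniquenessOfIdentityProofs using (module Decidable⇒UIP)
open import Relation.Nullary using (¬_; Dec; yes; no)
open import Relation.Nullary.Decidable using (recompute)
open import Relation.Binary.PropositionalEquality using (_≡_; _≢_; refl; sym; trans; cong; cong₂; subst; subst₂; module ≡-Reasoning)

transpose-matchˡ : ∀ {n} {i j x : Fin n} → x ≡ i → PC.transpose i j x ≡ j
transpose-matchˡ {i = i} {x = x} x≡i with x ≟ i
... | yes _   = refl
... | no  x≢i = ⊥-elim (x≢i x≡i)

transpose-matchʳ : ∀ {n} {i j x : Fin n} → x ≢ i → x ≡ j → PC.transpose i j x ≡ i
transpose-matchʳ {i = i} {j} {x} x≢i x≡j with x ≟ i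
... | yes x≡i = ⊥-elim (x≢i x≡i)
... | no  _ with x ≟ j
...   | yes _   = refl
...   | no  x≢j = ⊥-elim (x≢j x≡j)

transpose-fixes : ∀ {n} {i j x : Fin n} → x ≢ i → x ≢ j → PC.transpose i j x ≡ x
transpose-fixes {i = i} {j} {x} x≢i x≢j with x ≟ i
... | yes x≡i = ⊥-elim (x≢i x≡i)
... | no  _ with x ≟ j
...   | yes x≡j = ⊥-elim (x≢j x≡j)
...   | no  _   = refl

transpose-sym : ∀ {n} (i j x : Fin n) → PC.transpose i j x ≡ PC.transpose j i x
transpose-sym i j x = by-cases (x ≟ i) (x ≟ j)
  where
  by-cases : Dec (x ≡ i) → Dec (x ≡ j) → PC.transpose i j x ≡ PC.transpose j i x
  by-cases (yes x≡i) (yes x≡j) =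
    trans (transpose-matchˡ x≡i) (trans (trans (sym x≡j) x≡i) (sym (transpose-matchˡ x≡j)))
  by-cases (yes x≡i) (no x≢j) = trans (transpose-matchˡ x≡i) (sym (transpose-matchʳ x≢j x≡i))
  by-cases (no x≢i) (yes x≡j) = trans (transpose-matchʳ x≢i x≡j) (sym (transpose-matchˡ x≡j))
  by-cases (no x≢i) (no x≢j)  = trans (transpose-fixes x≢i x≢j) (sym (transpose-fixes x≢j x≢i))

-- Transpositions are involutions; the library only states that (i j) and
-- (j i) are mutually inverse.
transpose-involutive : ∀ {n} (i j x : Fin n) → PC.transpose i j (PC.transpose i j x) ≡ x
transpose-involutive i j x =
  trans (cong (PC.transpose i j) (transpose-sym i j x)) (PC.transpose-inverse i j)

transpose-relabel : ∀ {m n} {f : Fin m → Fin n} → Injective _≡_ _≡_ f →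
  (a b y : Fin m) → PC.transpose (f a) (f b) (f y) ≡ f (PC.transpose a b y)
transpose-relabel {f = f} f-inj a b y = by-cases (y ≟ a) (y ≟ b)
  where
  by-cases : Dec (y ≡ a) → Dec (y ≡ b) → PC.transpose (f a) (f b) (f y) ≡ f (PC.transpose a b y)
  by-cases (yes y≡a) _ =
    trans (transpose-matchˡ (cong f y≡a)) (sym (cong f (transpose-matchˡ y≡a)))
  by-cases (no y≢a) (yes y≡b) =
    trans (transpose-matchʳ (y≢a ∘ f-inj) (cong f y≡b)) (sym (cong f (transpose-matchʳ y≢a y≡b)))
  by-cases (no y≢a) (no y≢b) =
    trans (transpose-fixes (y≢a ∘ f-inj) (y≢b ∘ f-inj)) (sym (cong f (transpose-fixes y≢a y≢b)))

Factorizes : ∀ {k l} → Perm k → Vec (Fin k × Fin k) l → Set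
Factorizes σ ts = ∀ x → σ ⟨$⟩ʳ x ≡ prod ts ⟨$⟩ʳ x

peel-factorizes : ∀ {k l} {σ : Perm k} (s t : Fin k) (ts : Vec (Fin k × Fin k) l) →
  Factorizes σ ((s , t) ∷ ts) → Factorizes (transpose s t · σ) ts
peel-factorizes s t ts fa x =
  trans (cong (PC.transpose s t) (fa x)) (transpose-involutive s t _)

prepend-factorizes : ∀ {k l} {σ : Perm k} (s t : Fin k) (ts : Vec (Fin k × Fin k) l) →
  Factorizes (transpose s t · σ) ts → Factorizes σ ((s , t) ∷ ts)
prepend-factorizes {σ = σ} s t ts fa x =
  trans (sym (transpose-involutive s t (σ ⟨$⟩ʳ x))) (cong (PC.transpose s t) (fa x))

injectPair : ∀ {m} → Fin m × Fin m → Fin (suc m) × Fin (suc m)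
injectPair (s , t) = inject₁ s , inject₁ t

liftPairs : ∀ {m l} → Vec (Fin m × Fin m) l → Vec (Fin (suc m) × Fin (suc m)) l
liftPairs = map injectPair

prod-inject₁ : ∀ {m l} (ts : Vec (Fin m × Fin m) l) (y : Fin m) →
  prod (liftPairs ts) ⟨$⟩ʳ inject₁ y ≡ inject₁ (prod ts ⟨$⟩ʳ y)
prod-inject₁ []             y = refl
prod-inject₁ ((s , t) ∷ ts) y =
  trans (cong (PC.transpose (inject₁ s) (inject₁ t)) (prod-inject₁ ts y))
        (transpose-relabel inject₁-injective s t (prod ts ⟨$⟩ʳ y))

prod-fixesLast : ∀ {m l} (ts : Vec (Fin m × Fin m) l) → FixesLast (prod (liftPairs ts))
prod-fixesLast []             = refl
prod-fixesLast ((s , t) ∷ ts) =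
  trans (cong (PC.transpose (inject₁ s) (inject₁ t)) (prod-fixesLast ts))
        (transpose-fixes fromℕ≢inject₁ fromℕ≢inject₁)

punchIn-fromℕ : ∀ {m} (y : Fin m) → punchIn (fromℕ m) y ≡ inject₁ y
punchIn-fromℕ Fin.zero    = refl
punchIn-fromℕ (Fin.suc y) = cong Fin.suc (punchIn-fromℕ y)

restrict-inject₁ : ∀ {m} (σ : Perm (suc m)) → FixesLast σ → ∀ y →
  σ ⟨$⟩ʳ inject₁ y ≡ inject₁ (restrict σ ⟨$⟩ʳ y)
restrict-inject₁ {m} σ fixes y = begin
  σ ⟨$⟩ʳ inject₁ y                                 ≡⟨ cong (σ ⟨$⟩ʳ_) (sym (punchIn-fromℕ y)) ⟩
  σ ⟨$⟩ʳ punchIn (fromℕ m) y                       ≡⟨ punchIn-permute σ (fromℕ m) y ⟩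
  punchIn (σ ⟨$⟩ʳ fromℕ m) (restrict σ ⟨$⟩ʳ y)     ≡⟨ cong (λ z → punchIn z (restrict σ ⟨$⟩ʳ y)) fixes ⟩
  punchIn (fromℕ m) (restrict σ ⟨$⟩ʳ y)            ≡⟨ punchIn-fromℕ _ ⟩
  inject₁ (restrict σ ⟨$⟩ʳ y)                      ∎
  where open ≡-Reasoning

lift-factorizes : ∀ {m l} {σ : Perm (suc m)} (ts : Vec (Fin m × Fin m) l) →
  FixesLast σ → Factorizes (restrict σ) ts → Factorizes σ (liftPairs ts)
lift-factorizes {σ = σ} ts fixes fa x with view x
... | ‵fromℕ     = trans fixes (sym (prod-fixesLast ts))
... | ‵inject₁ y = begin
  σ ⟨$⟩ʳ inject₁ y                   ≡⟨ restrict-inject₁ σ fixes y ⟩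
  inject₁ (restrict σ ⟨$⟩ʳ y)        ≡⟨ cong inject₁ (fa y) ⟩
  inject₁ (prod ts ⟨$⟩ʳ y)           ≡⟨ prod-inject₁ ts y ⟨
  prod (liftPairs ts) ⟨$⟩ʳ inject₁ y ∎
  where open ≡-Reasoning

lower-fixesLast : ∀ {m l} {σ : Perm (suc m)} (ts : Vec (Fin m × Fin m) l) →
  Factorizes σ (liftPairs ts) → FixesLast σ
lower-fixesLast {m} ts fa = trans (fa (fromℕ m)) (prod-fixesLast ts)

lower-factorizes : ∀ {m l} {σ : Perm (suc m)} (ts : Vec (Fin m × Fin m) l) →
  FixesLast σ → Factorizes σ (liftPairs ts) → Factorizes (restrict σ) ts
lower-factorizes {σ = σ} ts fixes fa y = inject₁-injective (begin
  inject₁ (restrict σ ⟨$⟩ʳ y)        ≡⟨ restrict-inject₁ σ fixes y ⟨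
  σ ⟨$⟩ʳ inject₁ y                   ≡⟨ fa (inject₁ y) ⟩
  prod (liftPairs ts) ⟨$⟩ʳ inject₁ y ≡⟨ prod-inject₁ ts y ⟩
  inject₁ (prod ts ⟨$⟩ʳ y)           ∎)
  where open ≡-Reasoning

tops : ∀ {k l} → Vec (Fin k × Fin k) l → Vec ℕ l
tops = map (λ p → toℕ (proj₂ p))

Ordered : ∀ {k} → Fin k × Fin k → Set
Ordered p = toℕ (proj₁ p) < toℕ (proj₂ p)

desc-tail : ∀ {l} (x : ℕ) (v : Vec ℕ l) → Desc (x ∷ v) → Desc v
desc-tail x []      _       = tt
desc-tail x (y ∷ v) (_ , d) = d

-- Every top is at most m+1, so m+1 may be prepended to any sequence of tops.
desc-fromℕ : ∀ {m l} (ts : Vec (Fin (suc m) × Fin (suc m)) l) →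
  Desc (tops ts) → Desc (toℕ (fromℕ m) ∷ tops ts)
desc-fromℕ []             _ = tt
desc-fromℕ ((s , t) ∷ ts) d = ≤fromℕ t , d

tops-liftPairs : ∀ {m l} (ts : Vec (Fin m × Fin m) l) → tops (liftPairs ts) ≡ tops ts
tops-liftPairs ts = trans (sym (map-∘ _ injectPair ts)) (map-cong (λ p → toℕ-inject₁ (proj₂ p)) ts)

ordered-liftPairs : ∀ {m l} (ts : Vec (Fin m × Fin m) l) → All Ordered ts → All Ordered (liftPairs ts)
ordered-liftPairs []             []       = []
ordered-liftPairs ((s , t) ∷ ts) (o ∷ os) =
  subst₂ _<_ (sym (toℕ-inject₁ s)) (sym (toℕ-inject₁ t)) o ∷ ordered-liftPairs ts os

ordered-unliftPairs : ∀ {m l} (ts : Vec (Fin m × Fin m) l) → All Ordered (liftPairs ts) → All Ordered ts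
ordered-unliftPairs []             []       = []
ordered-unliftPairs ((s , t) ∷ ts) (o ∷ os) =
  subst₂ _<_ (toℕ-inject₁ s) (toℕ-inject₁ t) o ∷ ordered-unliftPairs ts os

Below : ∀ {k l} (m : ℕ) → Vec (Fin k × Fin k) l → Set
Below m = All (λ p → toℕ (proj₁ p) < m × toℕ (proj₂ p) < m)

below-[] : ∀ {k} (m : ℕ) (ts : Vec (Fin k × Fin k) 0) → Below m ts
below-[] m [] = []

-- In a monotone sequence every point is below the first top, hence below
-- any bound on it.
monotone-below : ∀ {k l m} (ts : Vec (Fin k × Fin k) (suc l)) →
  All Ordered ts → Desc (tops ts) → toℕ (proj₂ (Vec.head ts)) < m → Below m ts
monotone-below ((s , t) ∷ [])             (o ∷ [])  _          t<m = (<-trans o t<m , t<m) ∷ []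
monotone-below ((s , t) ∷ (s′ , t′) ∷ ts) (o ∷ os)  (t′≤t , d) t<m =
  (<-trans o t<m , t<m) ∷ monotone-below ((s′ , t′) ∷ ts) os d (≤-<-trans t′≤t t<m)

below-liftPairs : ∀ {m l} (ts : Vec (Fin m × Fin m) l) → Below m (liftPairs ts)
below-liftPairs []             = []
below-liftPairs ((s , t) ∷ ts) = (inject₁ℕ< s , inject₁ℕ< t) ∷ below-liftPairs ts

lowerPairs : ∀ {m l} (ts : Vec (Fin (suc m) × Fin (suc m)) l) → .(Below m ts) → Vec (Fin m × Fin m) l
lowerPairs []             _ = []
lowerPairs ((s , t) ∷ ts) b =
  (fromℕ< (proj₁ (All.head b)) , fromℕ< (proj₂ (All.head b))) ∷ lowerPairs ts (All.tail b)

inject₁-fromℕ< : ∀ {m} (s : Fin (suc m)) .(s<m : toℕ s < m) → inject₁ (fromℕ< s<m) ≡ s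
inject₁-fromℕ< s s<m = toℕ-injective (trans (toℕ-inject₁ _) (toℕ-fromℕ< s<m))

fromℕ<-inject₁ : ∀ {m} (s : Fin m) .(s<m : toℕ (inject₁ s) < m) → fromℕ< s<m ≡ s
fromℕ<-inject₁ s s<m = toℕ-injective (trans (toℕ-fromℕ< s<m) (toℕ-inject₁ s))

liftPairs-lowerPairs : ∀ {m l} (ts : Vec (Fin (suc m) × Fin (suc m)) l) .(b : Below m ts) →
  liftPairs (lowerPairs ts b) ≡ ts
liftPairs-lowerPairs []             _ = refl
liftPairs-lowerPairs ((s , t) ∷ ts) b =
  cong₂ _∷_ (cong₂ _,_ (inject₁-fromℕ< s _) (inject₁-fromℕ< t _)) (liftPairs-lowerPairs ts _)

lowerPairs-liftPairs : ∀ {m l} (ts : Vec (Fin m × Fin m) l) .(b : Below m (liftPairs ts)) →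
  lowerPairs (liftPairs ts) b ≡ ts
lowerPairs-liftPairs []             _ = refl
lowerPairs-liftPairs ((s , t) ∷ ts) b =
  cong₂ _∷_ (cong₂ _,_ (fromℕ<-inject₁ s _) (fromℕ<-inject₁ t _)) (lowerPairs-liftPairs ts _)

F-ext : ∀ {k l} {σ : Perm k} {f g : F σ l} → F.ts f ≡ F.ts g → f ≡ g
F-ext {f = record {}} {g = record {}} refl = refl

FixesLast-irrelevant : ∀ {m} {σ : Perm (suc m)} (p q : FixesLast σ) → p ≡ q
FixesLast-irrelevant = Decidable⇒UIP.≡-irrelevant _≟_

prepend : ∀ {m l} {σ : Perm (suc m)} (j : Fin m) → F (τ j · σ) l → F σ (suc l)
prepend {m} {σ = σ} j record { ts = ts ; lt = lt ; mono = mono ; fact = fact } = record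
  { ts   = (inject₁ j , fromℕ m) ∷ ts
  ; lt   = subst (toℕ (inject₁ j) <_) (sym (toℕ-fromℕ m)) (inject₁ℕ< j) ∷ lt
  ; mono = desc-fromℕ ts mono
  ; fact = prepend-factorizes {σ = σ} (inject₁ j) (fromℕ m) ts fact }

lift : ∀ {m l} {σ : Perm (suc m)} → FixesLast σ → F (restrict σ) l → F σ l
lift {σ = σ} fixes record { ts = ts ; lt = lt ; mono = mono ; fact = fact } = record
  { ts   = liftPairs ts
  ; lt   = ordered-liftPairs ts lt
  ; mono = subst Desc (sym (tops-liftPairs ts)) mono
  ; fact = lift-factorizes {σ = σ} ts fixes fact }

lower : ∀ {m l} {σ : Perm (suc m)} (f : F σ l) → .(Below m (F.ts f)) →
  FixesLast σ × F (restrict σ) l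
lower {m} {σ = σ} record { ts = ts ; lt = lt ; mono = mono ; fact = fact } b = fixes , record
  { ts   = lowered
  ; lt   = ordered-unliftPairs lowered (subst (All Ordered) (sym lifted) lt)
  ; mono = subst Desc (tops-liftPairs lowered) (subst (Desc ∘ tops) (sym lifted) mono)
  ; fact = lower-factorizes {σ = σ} lowered fixes (subst (Factorizes σ) (sym lifted) fact) }
  where
  lowered : Vec (Fin m × Fin m) _
  lowered = lowerPairs ts b
  lifted : liftPairs lowered ≡ ts
  lifted = liftPairs-lowerPairs ts b
  -- σ(m+1) = m+1 is decidable, so it can be recovered from the irrelevant `fact`.
  fixes : FixesLast σ
  fixes = recompute (σ ⟨$⟩ʳ fromℕ m ≟ fromℕ m)
                    (lower-fixesLast {σ = σ} lowered (subst (Factorizes σ) (sym lifted) fact))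

lift-lower : ∀ {m l} {σ : Perm (suc m)} (f : F σ l) .(b : Below m (F.ts f)) →
  uncurry lift (lower f b) ≡ f
lift-lower f b = F-ext (liftPairs-lowerPairs (F.ts f) b)

lower-lift : ∀ {m l} {σ : Perm (suc m)} (fixes : FixesLast σ) (g : F (restrict σ) l) →
  lower (lift {σ = σ} fixes g) (below-liftPairs (F.ts g)) ≡ (fixes , g)
lower-lift {σ = σ} fixes g =
  cong₂ _,_ (FixesLast-irrelevant {σ = σ} _ _) (F-ext (lowerPairs-liftPairs (F.ts g) _))

Step : (A : ∀ {k} → Perm k → ℕ → Set) → ∀ {m} → Perm (suc m) → ℕ → Set
Step A {m} σ l = (Σ[ j ∈ Fin m ] A (τ j · σ) l) ⊎ (FixesLast σ × A (restrict σ) (suc l))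

F-S₀ : (σ : Perm 0) → F σ 0 ↔ ⊤
F-S₀ σ = mk↔ₛ′ (λ _ → tt) (λ _ → empty) (λ _ → refl) (λ { record { ts = [] } → refl })
  where
  empty : F σ 0
  empty = record { ts = [] ; lt = [] ; mono = tt ; fact = λ () }

F-S₀-suc : (σ : Perm 0) (l : ℕ) → ¬ F σ (suc l)
F-S₀-suc σ l record { ts = (() , _) ∷ _ }

-- A factorization of length 0 never moves m+1.
F-base : ∀ {m} (σ : Perm (suc m)) → F σ 0 ↔ (FixesLast σ × F (restrict σ) 0)
F-base {m} σ = mk↔ₛ′ (λ f → lower f (below-[] m (F.ts f))) (uncurry (lift {σ = σ}))
  (uncurry (lower-lift {σ = σ})) (λ f → lift-lower f _)

-- Classify a factorization by its first transposition (s, t): either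
-- t = m+1, and then s = j for some j ≤ m, or t ≤ m, and then no
-- transposition moves m+1 by monotonicity.
split : ∀ {m l} {σ : Perm (suc m)} → F σ (suc l) → Step F σ l
split {σ = σ} f@record { ts = (s , t) ∷ ts ; lt = lt ; mono = mono ; fact = fact } with view t
... | ‵inject₁ t′ = inj₂ (lower f (monotone-below (F.ts f) lt mono (inject₁ℕ< t′)))
... | ‵fromℕ with view s
...   | ‵fromℕ     = ⊥-elim-irr (<-irrefl refl (All.head lt))
...   | ‵inject₁ j = inj₁ (j , record
  { ts   = ts
  ; lt   = All.tail lt
  ; mono = desc-tail _ (tops ts) mono
  ; fact = peel-factorizes {σ = σ} (inject₁ j) (fromℕ _) ts fact })

join : ∀ {m l} {σ : Perm (suc m)} → Step F σ l → F σ (suc l)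
join {σ = σ} = [ uncurry (prepend {σ = σ}) , uncurry (lift {σ = σ}) ]

split-join : ∀ {m l} {σ : Perm (suc m)} (x : Step F σ l) → split (join {σ = σ} x) ≡ x
split-join {m} (inj₁ (j , g)) rewrite view-fromℕ m | view-inject₁ j = refl
split-join {σ = σ} (inj₂ (fixes , g@record { ts = (s , t) ∷ _ })) rewrite view-inject₁ t =
  cong inj₂ (lower-lift {σ = σ} fixes g)

join-split : ∀ {m l} {σ : Perm (suc m)} (f : F σ (suc l)) → join {σ = σ} (split f) ≡ f
join-split f@record { ts = (s , t) ∷ ts ; lt = lt ; mono = mono } with view t
... | ‵inject₁ t′ = lift-lower f (monotone-below (F.ts f) lt mono (inject₁ℕ< t′))
... | ‵fromℕ with view s
...   | ‵fromℕ     = ⊥-elim-irr (<-irrefl refl (All.head lt))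
...   | ‵inject₁ j = refl

F-step : ∀ {m} (σ : Perm (suc m)) (l : ℕ) → F σ (suc l) ↔ Step F σ l
F-step σ l = mk↔ₛ′ split join split-join join-split

-- Each dashed arrow lowers the size by one, so a walk from S_k to ∅ has
-- at least k arrows.
walk-length : ∀ {k} (σ : Perm k) (n : ℕ) → n < k → ¬ Walk k σ n
walk-length {suc m} σ zero    _   ()
walk-length {suc m} σ (suc n) n<k (inj₁ (_ , w)) = walk-length _ n (<-trans (n<1+n n) n<k) w
walk-length {suc m} σ (suc n) n<k (inj₂ (_ , w)) = walk-length _ n (s≤s⁻¹ n<k) w

-- Walks are indexed by their length, which is only propositionally l + k.
reindex : ∀ {k} {σ : Perm k} {n n′ : ℕ} → n ≡ n′ → Walk k σ n ↔ Walk k σ n′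
reindex refl = ↔-refl

empty↔⊥ : ∀ {A : Set} → ¬ A → A ↔ ⊥
empty↔⊥ ¬a = mk↔ₛ′ ¬a (λ ()) (λ ()) (λ a → ⊥-elim (¬a a))

drop-emptyˡ : ∀ {A B : Set} → ¬ A → (A ⊎ B) ↔ B
drop-emptyˡ ¬a = mk↔ₛ′ [ ⊥-elim ∘ ¬a , (λ b → b) ] inj₂ (λ _ → refl) [ ⊥-elim ∘ ¬a , (λ _ → refl) ]

-- With no solid arrow left, a walk is too short to start with one.
P-base : ∀ {m} (σ : Perm (suc m)) → P σ 0 ↔ (FixesLast σ × P (restrict σ) 0)
P-base {m} σ = drop-emptyˡ λ (_ , w) → walk-length _ m (n<1+n m) w

-- A walk with l+1 solid arrows starts with a solid or a dashed arrow; after a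
-- dashed one it still has l+1 solid arrows but one dashed arrow fewer.
P-step : ∀ {m} (σ : Perm (suc m)) (l : ℕ) → P σ (suc l) ↔ Step P σ l
P-step {m} σ l = ↔-refl ⊎-↔ (↔-refl ×-↔ reindex (+-suc l m))

P↔F : ∀ k (σ : Perm k) l → P σ l ↔ F σ l
P↔F zero    σ zero    = ↔-sym (F-S₀ σ)
P↔F zero    σ (suc l) = ↔-sym (empty↔⊥ (F-S₀-suc σ l))
P↔F (suc m) σ zero    = begin
  P σ 0                             ↔⟨ P-base σ ⟩
  (FixesLast σ × P (restrict σ) 0)  ↔⟨ ↔-refl ×-↔ P↔F m (restrict σ) 0 ⟩
  (FixesLast σ × F (restrict σ) 0)  ↔⟨ F-base σ ⟨
  F σ 0                             ∎
  where open EquationalReasoning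
P↔F (suc m) σ (suc l) = begin
  P σ (suc l)  ↔⟨ P-step σ l ⟩
  Step P σ l   ↔⟨ congˡ (λ {j} → P↔F (suc m) (τ j · σ) l)
                   ⊎-↔ (↔-refl ×-↔ P↔F m (restrict σ) (suc l)) ⟩
  Step F σ l   ↔⟨ F-step σ l ⟨
  F σ (suc l)  ∎
  where open EquationalReasoning

lemma2p8 : (k : ℕ) (σ : Perm k) (l : ℕ) → P σ l ⤖ F σ l
lemma2p8 k σ l = ↔⇒⤖ (P↔F k σ l)
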